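{- Let $\delta:\mathrm{Bag}(\tau)\to\mathrm{Bag}(\tau)$ be an aggregation function, let $\delta(\mathrm{Bag}(\tau))$ be its image, and define on bags $a\otimes_\delta b=\delta(a\uplus b)$. Then $(\delta(\mathrm{Bag}(\tau)),\otimes_\delta,\{\!\!\})$ is a monoid $M_\delta$, isomorphic to the quotient monoid $(\mathrm{Bag}(\tau),\uplus,\{\!\!\})/\equiv_\delta$, where $a\equiv_\delta b$ iff $\delta(a)=\delta(b)$; and $\delta$ is a monoid homomorphism from $(\mathrm{Bag}(\tau),\uplus,\{\!\!\})$ to $M_\delta$.
   Context: $\mathrm{Bag}(\tau)$ denotes the set of finite bags (multisets) of values of type $\tau$, with bag union $\uplus$ and empty bag $\{\!\!\}$; it is a monoid. An aggregation function is a function $\delta:\mathrm{Bag}(\tau)\to\mathrm{Bag}(\tau)$ such that $\delta(\{\!\!\})=\{\!\!\}$ and $\delta(a\uplus b)=\delta(\delta(a)\uplus\delta(b))$ for all bags $a,b$. The quotient of a monoid by a congruence $\sim$ (an equivalence relation compatible with the operation) is the set of equivalence classes with the induced operation. -}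

module Defs where

open import Level using (Level)
open import Data.List using (List; []; _++_)
open import Data.List.Relation.Binary.Permutation.Propositional using (_↭_)
open import Data.Product using (Σ; ∃; _,_; proj₁; _×_)
open import Algebra.Bundles.Raw using (RawMonoid)

-- Bag(τ): finite lists of elements of τ, with bag equality = permutation (_↭_).
-- A function on bags is a function on lists respecting _↭_.
Bag : Set → Set
Bag τ = List τ

_≈Bag_ : {τ : Set} → Bag τ → Bag τ → Set
_≈Bag_ = _↭_

record IsAggregation {τ : Set} (δ : Bag τ → Bag τ) : Set where
  field
    δ-cong  : ∀ {a b} → a ↭ b → δ a ↭ δ b
    δ-empty : δ [] ↭ []
    δ-merge : ∀ a b → δ (a ++ b) ↭ δ (δ a ++ δ b)

BagRaw : Set → RawMonoid _ _
BagRaw τ = record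
  { Carrier = Bag τ ; _≈_ = _↭_ ; _∙_ = _++_ ; ε = [] }

Image : {τ : Set} → (Bag τ → Bag τ) → Set
Image {τ} δ = Σ (Bag τ) (λ x → ∃ λ (a : Bag τ) → x ↭ δ a)

_≈Img_ : {τ : Set} {δ : Bag τ → Bag τ} → Image δ → Image δ → Set
x ≈Img y = proj₁ x ↭ proj₁ y

⊗δ : {τ : Set} (δ : Bag τ → Bag τ) → Image δ → Image δ → Image δ
⊗δ δ x y = δ (proj₁ x ++ proj₁ y) , (proj₁ x ++ proj₁ y) , _↭_.refl

emptyImg : {τ : Set} (δ : Bag τ → Bag τ) → IsAggregation δ → Image δ
emptyImg δ agg = [] , [] , Data.List.Relation.Binary.Permutation.Propositional.↭-sym (IsAggregation.δ-empty agg)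

MδRaw : {τ : Set} (δ : Bag τ → Bag τ) → IsAggregation δ → RawMonoid _ _
MδRaw δ agg = record
  { Carrier = Image δ ; _≈_ = _≈Img_ ; _∙_ = ⊗δ δ ; ε = emptyImg δ agg }

_≡[_]_ : {τ : Set} → Bag τ → (Bag τ → Bag τ) → Bag τ → Set
a ≡[ δ ] b = δ a ↭ δ b

QuotRaw : {τ : Set} (δ : Bag τ → Bag τ) → RawMonoid _ _
QuotRaw {τ} δ = record
  { Carrier = Bag τ ; _≈_ = λ a b → a ≡[ δ ] b ; _∙_ = _++_ ; ε = [] }

δImg : {τ : Set} (δ : Bag τ → Bag τ) → Bag τ → Image δ
δImg δ a = δ a , a , _↭_.refl

{-# OPTIONS --safe #-}
-- The merge law δ(a ⊎ b) = δ(δ a ⊎ δ b) with b = {||} gives idempotence, δ(δ a) = δ a;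
-- hence δ may be applied to or removed from either argument of a union without
-- changing δ of the result. This makes ⊗δ associative, and makes the elements of the
-- image fixed points, so that {||} is a unit. Being a homomorphism onto M_δ whose
-- kernel is ≡δ by definition, δ is an isomorphism from the quotient, and the quotient
-- inherits its monoid laws from M_δ along this injective homomorphism.
module Submission where

open import Defs
open import Data.Product using (Σ; _×_; _,_; proj₁)
open import Data.List using ([]; _++_)
open import Data.List.Properties using (++-assoc; ++-identityʳ)
open import Data.List.Relation.Binary.Permutation.Propositional
  using (_↭_; ↭-refl; ↭-reflexive; ↭-sym; ↭-trans; module PermutationReasoning)
open import Data.List.Relation.Binary.Permutation.Propositional.Properties using (++⁺)
open import Relation.Binary.PropositionalEquality using (cong)
open import Algebra.Bundles.Raw using (RawMonoid)
open import Algebra.Structures using (IsMonoid)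
open import Algebra.Morphism.Structures using (module MonoidMorphisms)
import Algebra.Morphism.MonoidMonomorphism as MonoidMonomorphism

module Aggregation {τ : Set} {δ : Bag τ → Bag τ} (agg : IsAggregation δ) where
  open IsAggregation agg
  open MonoidMorphisms
  open PermutationReasoning

  δ-idempotent : ∀ a → δ (δ a) ↭ δ a
  δ-idempotent a = ↭-sym (begin
    δ a               ≡⟨ cong δ (++-identityʳ a) ⟨
    δ (a ++ [])       ↭⟨ δ-merge a [] ⟩
    δ (δ a ++ δ [])   ↭⟨ δ-cong (++⁺ ↭-refl δ-empty) ⟩
    δ (δ a ++ [])     ≡⟨ cong δ (++-identityʳ (δ a)) ⟩
    δ (δ a)           ∎)

  δ-absorbˡ : ∀ a b → δ (δ a ++ b) ↭ δ (a ++ b)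
  δ-absorbˡ a b = begin
    δ (δ a ++ b)          ↭⟨ δ-merge (δ a) b ⟩
    δ (δ (δ a) ++ δ b)    ↭⟨ δ-cong (++⁺ (δ-idempotent a) ↭-refl) ⟩
    δ (δ a ++ δ b)        ↭⟨ δ-merge a b ⟨
    δ (a ++ b)            ∎

  δ-absorbʳ : ∀ a b → δ (a ++ δ b) ↭ δ (a ++ b)
  δ-absorbʳ a b = begin
    δ (a ++ δ b)          ↭⟨ δ-merge a (δ b) ⟩
    δ (δ a ++ δ (δ b))    ↭⟨ δ-cong (++⁺ ↭-refl (δ-idempotent b)) ⟩
    δ (δ a ++ δ b)        ↭⟨ δ-merge a b ⟨
    δ (a ++ b)            ∎

  δ-fixes-image : (x : Image δ) → δ (proj₁ x) ↭ proj₁ x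
  δ-fixes-image (x , a , x↭δa) = begin
    δ x        ↭⟨ δ-cong x↭δa ⟩
    δ (δ a)    ↭⟨ δ-idempotent a ⟩
    δ a        ↭⟨ x↭δa ⟨
    x          ∎

  ⊗δ-assoc : ∀ a b c → δ (δ (a ++ b) ++ c) ↭ δ (a ++ δ (b ++ c))
  ⊗δ-assoc a b c = begin
    δ (δ (a ++ b) ++ c)   ↭⟨ δ-absorbˡ (a ++ b) c ⟩
    δ ((a ++ b) ++ c)     ≡⟨ cong δ (++-assoc a b c) ⟩
    δ (a ++ (b ++ c))     ↭⟨ δ-absorbʳ a (b ++ c) ⟨
    δ (a ++ δ (b ++ c))   ∎

  Mδ-isMonoid : IsMonoid (RawMonoid._≈_ (MδRaw δ agg)) (RawMonoid._∙_ (MδRaw δ agg))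
                         (RawMonoid.ε (MδRaw δ agg))
  Mδ-isMonoid = record
    { isSemigroup = record
      { isMagma = record
        { isEquivalence = record { refl = ↭-refl ; sym = ↭-sym ; trans = ↭-trans }
        ; ∙-cong        = λ x↭x′ y↭y′ → δ-cong (++⁺ x↭x′ y↭y′)
        }
      ; assoc = λ x y z → ⊗δ-assoc (proj₁ x) (proj₁ y) (proj₁ z)
      }
    ; identity = δ-fixes-image
               , λ x → ↭-trans (↭-reflexive (cong δ (++-identityʳ (proj₁ x)))) (δ-fixes-image x)
    }

  δImg-isMonoidHomomorphism : IsMonoidHomomorphism (BagRaw τ) (MδRaw δ agg) (δImg δ)
  δImg-isMonoidHomomorphism = record
    { isMagmaHomomorphism = record
      { isRelHomomorphism = record { cong = δ-cong }
      ; homo              = δ-merge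
      }
    ; ε-homo = δ-empty
    }

  δImg-isMonoidMonomorphism : IsMonoidMonomorphism (QuotRaw δ) (MδRaw δ agg) (δImg δ)
  δImg-isMonoidMonomorphism = record
    { isMonoidHomomorphism = record
      { isMagmaHomomorphism = record
        { isRelHomomorphism = record { cong = λ δa↭δb → δa↭δb }
        ; homo              = δ-merge
        }
      ; ε-homo = δ-empty
      }
    ; injective = λ δa↭δb → δa↭δb
    }

  δImg-isMonoidIsomorphism : IsMonoidIsomorphism (QuotRaw δ) (MδRaw δ agg) (δImg δ)
  δImg-isMonoidIsomorphism = record
    { isMonoidMonomorphism = δImg-isMonoidMonomorphism
    ; surjective           = λ { (x , a , x↭δa) → a , λ δb↭δa → ↭-trans δb↭δa (↭-sym x↭δa) }
    }

  quotient-isMonoid : IsMonoid (RawMonoid._≈_ (QuotRaw δ)) (RawMonoid._∙_ (QuotRaw δ))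
                               (RawMonoid.ε (QuotRaw δ))
  quotient-isMonoid = MonoidMonomorphism.isMonoid δImg-isMonoidMonomorphism Mδ-isMonoid

open Aggregation

mainTheorem2 : (τ : Set) (δ : Bag τ → Bag τ) (agg : IsAggregation δ) →
    IsMonoid (RawMonoid._≈_ (MδRaw δ agg)) (RawMonoid._∙_ (MδRaw δ agg)) (RawMonoid.ε (MδRaw δ agg))
    × IsMonoid (RawMonoid._≈_ (QuotRaw δ)) (RawMonoid._∙_ (QuotRaw δ)) (RawMonoid.ε (QuotRaw δ))
    × Σ (Bag τ → Image δ) (λ φ → MonoidMorphisms.IsMonoidIsomorphism (QuotRaw δ) (MδRaw δ agg) φ)
    × MonoidMorphisms.IsMonoidHomomorphism (BagRaw τ) (MδRaw δ agg) (δImg δ)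
mainTheorem2 τ δ agg =
  Mδ-isMonoid agg , quotient-isMonoid agg , (δImg δ , δImg-isMonoidIsomorphism agg) ,
  δImg-isMonoidHomomorphism agg
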